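{- Let $m$ be a natural number with $m\equiv 0\pmod 4$. Then $P_m(x,y,z)=p_m(x)+p_m(y)+p_m(z)$, with $p_m(x)=\frac{(m-2)x^2-(m-4)x}{2}$ and $x,y,z\in\mathbb{Z}$, is not almost universal.
   Context: A form is almost universal if it represents all but finitely many natural numbers. -}

module Defs where

open import Data.Nat using (ℕ; _≥_)
open import Data.Integer using (ℤ; +_; _+_; _-_; _*_)
open import Data.Integer.DivMod using (_/_)
open import Data.Product using (∃; ∃-syntax)
open import Relation.Binary.PropositionalEquality using (_≡_)

-- generalized m-gonal number p_m(x) = ((m-2)x^2 - (m-4)x)/2, x ∈ ℤ
-- (the numerator is always even, so integer division by 2 is exact)
p : ℕ → ℤ → ℤ
p m x = ((+ m - + 2) * (x * x) - (+ m - + 4) * x) / + 2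

P : ℕ → ℤ → ℤ → ℤ → ℤ
P m x y z = p m x + p m y + p m z

Represents : ℕ → ℕ → Set
Represents m n = ∃[ x ] ∃[ y ] ∃[ z ] P m x y z ≡ + n

AlmostUniversal : ℕ → Set
AlmostUniversal m = ∃[ N ] ((n : ℕ) → n ≥ N → Represents m n)

-- For m = 8j + 4 one computes p_m(x) = x² + 4j(x² - x), and for m = 8j,
-- p_m(x) = 1 - (x - 1)² + 4j(x² - x). As x² - x is even, p_m(x) is congruent mod 8 to a square,
-- resp. to 1 minus a square. A sum of three squares is never 7 mod 8, so P_m misses every
-- n ≡ 7, resp. every n ≡ 3 - 7 ≡ 4, mod 8.
module Submission where

open import Defs
open import Data.Nat as ℕ using (ℕ; zero; suc; _%_; _<_; z<s; s<s)
import Data.Nat.Properties as ℕₚ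
open import Data.Nat.Divisibility using (m%n≡0⇒n∣m; divides) renaming (_∣_ to _∣ℕ_)
open import Data.Integer using (ℤ; +_; -[1+_]; _+_; _-_; _*_; -_; NonZero)
  renaming (_/_ to _/ℤ_; _%_ to _%ℤ_)
open import Data.Integer.Properties using (pos-+; pos-*; *-cancelʳ-≡; +-identityˡ)
open import Data.Integer.DivMod using (a≡a%n+[a/n]*n; n%d<d)
open import Data.Integer.Divisibility.Signed
  using (_∣_; divides; _∣?_; ∣-refl; ∣m∣n⇒∣m+n; ∣m∣n⇒∣m-n; ∣m⇒∣-m; ∣n⇒∣m*n)
open import Data.Integer.Tactic.RingSolver using (solve-∀)
open import Data.Product using (∃-syntax; _,_)
open import Data.Sum using (_⊎_; inj₁; inj₂)
open import Function using (_∘_)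
open import Relation.Nullary using (¬_; ¬?; contradiction)
open import Relation.Nullary.Decidable using (Dec; toWitness; map′)
open import Relation.Binary.PropositionalEquality
  using (_≡_; _≢_; refl; sym; trans; cong; subst; module ≡-Reasoning)
open ≡-Reasoning

infix 4 _≡_mod_ _≡?_mod_

record _≡_mod_ (a b n : ℤ) : Set where
  constructor mod-divides
  field divides-difference : n ∣ a - b

_≡?_mod_ : ∀ a b n → Dec (a ≡ b mod n)
a ≡? b mod n = map′ mod-divides _≡_mod_.divides-difference (n ∣? a - b)

module _ {n : ℤ} where

  ≡-mod-sym : ∀ {a b} → a ≡ b mod n → b ≡ a mod n
  ≡-mod-sym {a} {b} (mod-divides p) = mod-divides (subst (n ∣_) (swap a b) (∣m⇒∣-m p))
    where
    swap : ∀ a b → - (a - b) ≡ b - a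
    swap = solve-∀

  ≡-mod-trans : ∀ {a b c} → a ≡ b mod n → b ≡ c mod n → a ≡ c mod n
  ≡-mod-trans {a} {b} {c} (mod-divides p) (mod-divides q) =
    mod-divides (subst (n ∣_) (telescope a b c) (∣m∣n⇒∣m+n p q))
    where
    telescope : ∀ a b c → (a - b) + (b - c) ≡ a - c
    telescope = solve-∀

  +-cong-mod : ∀ {a b c d} → a ≡ b mod n → c ≡ d mod n → a + c ≡ b + d mod n
  +-cong-mod {a} {b} {c} {d} (mod-divides p) (mod-divides q) =
    mod-divides (subst (n ∣_) (regroup a b c d) (∣m∣n⇒∣m+n p q))
    where
    regroup : ∀ a b c d → (a - b) + (c - d) ≡ (a + c) - (b + d)
    regroup = solve-∀

  -‿cong-mod : ∀ {a b c d} → a ≡ b mod n → c ≡ d mod n → a - c ≡ b - d mod n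
  -‿cong-mod {a} {b} {c} {d} (mod-divides p) (mod-divides q) =
    mod-divides (subst (n ∣_) (regroup a b c d) (∣m∣n⇒∣m-n p q))
    where
    regroup : ∀ a b c d → (a - b) - (c - d) ≡ (a - c) - (b - d)
    regroup = solve-∀

  *-cong-mod : ∀ {a b c d} → a ≡ b mod n → c ≡ d mod n → a * c ≡ b * d mod n
  *-cong-mod {a} {b} {c} {d} (mod-divides p) (mod-divides q) =
    mod-divides (subst (n ∣_) (regroup a b c d) (∣m∣n⇒∣m+n (∣n⇒∣m*n c p) (∣n⇒∣m*n b q)))
    where
    regroup : ∀ a b c d → c * (a - b) + b * (c - d) ≡ a * c - b * d
    regroup = solve-∀

  ∣-resp-≡-mod : ∀ {a b} → a ≡ b mod n → n ∣ b → n ∣ a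
  ∣-resp-≡-mod {a} {b} (mod-divides p) q = subst (n ∣_) (cancel a b) (∣m∣n⇒∣m+n p q)
    where
    cancel : ∀ a b → (a - b) + b ≡ a
    cancel = solve-∀

  ∣⇒+-≡-mod : ∀ a {d} → n ∣ d → a + d ≡ a mod n
  ∣⇒+-≡-mod a {d} = mod-divides ∘ subst (n ∣_) (cancel a d)
    where
    cancel : ∀ a d → d ≡ (a + d) - a
    cancel = solve-∀

≡-mod-% : ∀ a n .{{_ : NonZero n}} → a ≡ + (a %ℤ n) mod n
≡-mod-% a n = mod-divides (divides (a /ℤ n)
  (trans (cong (_- + (a %ℤ n)) (a≡a%n+[a/n]*n a n)) (cancel (+ (a %ℤ n)) _)))
  where
  cancel : ∀ r t → (r + t) - r ≡ t
  cancel = solve-∀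

three-residue-squares-≢7-mod-8 : ∀ {a} → a < 8 → ∀ {b} → b < 8 → ∀ {c} → c < 8 →
                                 ¬ (+ a * + a + + b * + b + + c * + c ≡ + 7 mod + 8)
three-residue-squares-≢7-mod-8 = toWitness {a? = ℕₚ.allUpTo? (λ a → ℕₚ.allUpTo? (λ b →
  ℕₚ.allUpTo? (λ c → ¬? (+ a * + a + + b * + b + + c * + c ≡? + 7 mod + 8)) 8) 8) 8} _

three-squares-≢7-mod-8 : ∀ x y z → ¬ (x * x + y * y + z * z ≡ + 7 mod + 8)
three-squares-≢7-mod-8 x y z ≡7 =
  three-residue-squares-≢7-mod-8 (n%d<d x (+ 8)) (n%d<d y (+ 8)) (n%d<d z (+ 8))
    (≡-mod-trans (≡-mod-sym (+-cong-mod (+-cong-mod (square x) (square y)) (square z))) ≡7)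
  where
  square : ∀ u → u * u ≡ + (u %ℤ + 8) * + (u %ℤ + 8) mod + 8
  square u = *-cong-mod (≡-mod-% u (+ 8)) (≡-mod-% u (+ 8))

square-minus-self-even : ∀ x → + 2 ∣ x * x - x
square-minus-self-even x =
  ∣-resp-≡-mod (-‿cong-mod (*-cong-mod x≡r x≡r) x≡r) (residue (n%d<d x (+ 2)))
  where
  x≡r : x ≡ + (x %ℤ + 2) mod + 2
  x≡r = ≡-mod-% x (+ 2)
  residue : ∀ {r} → r < 2 → + 2 ∣ + r * + r - + r
  residue z<s       = divides (+ 0) refl
  residue (s<s z<s) = divides (+ 0) refl

8∣4j[x²-x] : ∀ j x → + 8 ∣ j * + 4 * (x * x - x)
8∣4j[x²-x] j x with square-minus-self-even x
... | divides q x²-x≡2q = divides (j * q) (trans (cong (j * + 4 *_) x²-x≡2q) (regroup j q))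
  where
  regroup : ∀ j q → j * + 4 * (q * + 2) ≡ j * q * + 8
  regroup = solve-∀

double≢1 : ∀ a → a * + 2 ≢ + 1
double≢1 (+ zero)  ()
double≢1 (+ suc n) ()
double≢1 -[1+ n ]  ()

a*2≢1+q*2 : ∀ a q → a * + 2 ≢ + 1 + q * + 2
a*2≢1+q*2 a q 2a≡1+2q = double≢1 (a - q) (begin
  (a - q) * + 2                ≡⟨ distribute a q ⟩
  a * + 2 - q * + 2            ≡⟨ cong (_- q * + 2) 2a≡1+2q ⟩
  (+ 1 + q * + 2) - q * + 2    ≡⟨ cancel q ⟩
  + 1                          ∎)
  where
  distribute : ∀ a q → (a - q) * + 2 ≡ a * + 2 - q * + 2
  distribute = solve-∀
  cancel : ∀ q → (+ 1 + q * + 2) - q * + 2 ≡ + 1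
  cancel = solve-∀

[a*2]/2≡a : ∀ a → (a * + 2) /ℤ + 2 ≡ a
[a*2]/2≡a a with (a * + 2) %ℤ + 2 | a≡a%n+[a/n]*n (a * + 2) (+ 2) | n%d<d (a * + 2) (+ 2)
... | 0           | 2a≡2q   | _ = sym (*-cancelʳ-≡ a _ (+ 2) (trans 2a≡2q (+-identityˡ _)))
... | 1           | 2a≡1+2q | _ = contradiction 2a≡1+2q (a*2≢1+q*2 a ((a * + 2) /ℤ + 2))
... | suc (suc _) | _       | s<s (s<s ())

numerator≡2a⇒p≡a : ∀ m x a → (+ m - + 2) * (x * x) - (+ m - + 4) * x ≡ a * + 2 → p m x ≡ a
numerator≡2a⇒p≡a m x a numerator≡2a = trans (cong (_/ℤ + 2) numerator≡2a) ([a*2]/2≡a a)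

p[8j]≡ : ∀ j x → p (j ℕ.* 8) x ≡ + 1 - (x - + 1) * (x - + 1) + + j * + 4 * (x * x - x)
p[8j]≡ j x = numerator≡2a⇒p≡a (j ℕ.* 8) x _ (begin
  (+ (j ℕ.* 8) - + 2) * (x * x) - (+ (j ℕ.* 8) - + 4) * x
    ≡⟨ cong (λ M → (M - + 2) * (x * x) - (M - + 4) * x) (pos-* j 8) ⟩
  (+ j * + 8 - + 2) * (x * x) - (+ j * + 8 - + 4) * x
    ≡⟨ halve (+ j) x ⟩
  (+ 1 - (x - + 1) * (x - + 1) + + j * + 4 * (x * x - x)) * + 2 ∎)
  where
  halve : ∀ j x → (j * + 8 - + 2) * (x * x) - (j * + 8 - + 4) * x
                ≡ (+ 1 - (x - + 1) * (x - + 1) + j * + 4 * (x * x - x)) * + 2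
  halve = solve-∀

p[4+8j]≡ : ∀ j x → p (4 ℕ.+ j ℕ.* 8) x ≡ x * x + + j * + 4 * (x * x - x)
p[4+8j]≡ j x = numerator≡2a⇒p≡a (4 ℕ.+ j ℕ.* 8) x _ (begin
  (+ (4 ℕ.+ j ℕ.* 8) - + 2) * (x * x) - (+ (4 ℕ.+ j ℕ.* 8) - + 4) * x
    ≡⟨ cong (λ M → (M - + 2) * (x * x) - (M - + 4) * x)
            (trans (pos-+ 4 (j ℕ.* 8)) (cong (_+_ (+ 4)) (pos-* j 8))) ⟩
  (+ 4 + + j * + 8 - + 2) * (x * x) - (+ 4 + + j * + 8 - + 4) * x
    ≡⟨ halve (+ j) x ⟩
  (x * x + + j * + 4 * (x * x - x)) * + 2 ∎)
  where
  halve : ∀ j x → (+ 4 + j * + 8 - + 2) * (x * x) - (+ 4 + j * + 8 - + 4) * x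
                ≡ (x * x + j * + 4 * (x * x - x)) * + 2
  halve = solve-∀

p[8j]≡1-[x-1]²-mod-8 : ∀ j x → p (j ℕ.* 8) x ≡ + 1 - (x - + 1) * (x - + 1) mod + 8
p[8j]≡1-[x-1]²-mod-8 j x =
  subst (_≡ _ mod + 8) (sym (p[8j]≡ j x)) (∣⇒+-≡-mod _ (8∣4j[x²-x] (+ j) x))

p[4+8j]≡x²-mod-8 : ∀ j x → p (4 ℕ.+ j ℕ.* 8) x ≡ x * x mod + 8
p[4+8j]≡x²-mod-8 j x =
  subst (_≡ _ mod + 8) (sym (p[4+8j]≡ j x)) (∣⇒+-≡-mod _ (8∣4j[x²-x] (+ j) x))

P[4+8j]≢7-mod-8 : ∀ j x y z → ¬ (P (4 ℕ.+ j ℕ.* 8) x y z ≡ + 7 mod + 8)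
P[4+8j]≢7-mod-8 j x y z P≡7 =
  three-squares-≢7-mod-8 x y z (≡-mod-trans (≡-mod-sym P≡squares) P≡7)
  where
  P≡squares : P (4 ℕ.+ j ℕ.* 8) x y z ≡ x * x + y * y + z * z mod + 8
  P≡squares = +-cong-mod (+-cong-mod (p[4+8j]≡x²-mod-8 j x) (p[4+8j]≡x²-mod-8 j y))
                         (p[4+8j]≡x²-mod-8 j z)

P[8j]≢4-mod-8 : ∀ j x y z → ¬ (P (j ℕ.* 8) x y z ≡ + 4 mod + 8)
P[8j]≢4-mod-8 j x y z P≡4 = three-squares-≢7-mod-8 (x - + 1) (y - + 1) (z - + 1)
  (mod-divides (subst (+ 8 ∣_) (flip-sign (sq x) (sq y) (sq z))
                              (∣m∣n⇒∣m-n (∣m⇒∣-m difference) ∣-refl)))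
  where
  sq : ℤ → ℤ
  sq u = (u - + 1) * (u - + 1)
  P≡Σ[1-sq] : P (j ℕ.* 8) x y z ≡ (+ 1 - sq x) + (+ 1 - sq y) + (+ 1 - sq z) mod + 8
  P≡Σ[1-sq] = +-cong-mod (+-cong-mod (p[8j]≡1-[x-1]²-mod-8 j x) (p[8j]≡1-[x-1]²-mod-8 j y))
                           (p[8j]≡1-[x-1]²-mod-8 j z)
  difference : + 8 ∣ (+ 1 - sq x) + (+ 1 - sq y) + (+ 1 - sq z) - + 4
  difference = _≡_mod_.divides-difference (≡-mod-trans (≡-mod-sym P≡Σ[1-sq]) P≡4)
  flip-sign : ∀ a b c → - ((+ 1 - a) + (+ 1 - b) + (+ 1 - c) - + 4) - + 8 ≡ a + b + c - + 7
  flip-sign = solve-∀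

even-or-odd : ∀ k → ∃[ j ] (k ≡ j ℕ.* 2 ⊎ k ≡ 1 ℕ.+ j ℕ.* 2)
even-or-odd zero = 0 , inj₁ refl
even-or-odd (suc zero) = 0 , inj₂ refl
even-or-odd (suc (suc k)) with even-or-odd k
... | j , inj₁ refl = suc j , inj₁ refl
... | j , inj₂ refl = suc j , inj₂ refl

4∣m⇒m≡8j∨m≡4+8j : ∀ {m} → 4 ∣ℕ m → ∃[ j ] (m ≡ j ℕ.* 8 ⊎ m ≡ 4 ℕ.+ j ℕ.* 8)
4∣m⇒m≡8j∨m≡4+8j (divides k refl) with even-or-odd k
... | j , inj₁ refl = j , inj₁ (ℕₚ.*-assoc j 2 4)
... | j , inj₂ refl = j , inj₂ (cong (4 ℕ.+_) (ℕₚ.*-assoc j 2 4))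

misses-residue⇒¬AlmostUniversal : ∀ m d r .{{_ : ℕ.NonZero d}} →
  (∀ x y z → ¬ (P m x y z ≡ + r mod + d)) → ¬ AlmostUniversal m
misses-residue⇒¬AlmostUniversal m d r misses (N , represents)
  with represents (r ℕ.+ N ℕ.* d) (ℕₚ.≤-trans (ℕₚ.m≤m*n N d) (ℕₚ.m≤n+m (N ℕ.* d) r))
... | x , y , z , P≡n = misses x y z (subst (_≡ + r mod + d) (sym P≡n) n≡r)
  where
  n≡r : + (r ℕ.+ N ℕ.* d) ≡ + r mod + d
  n≡r = mod-divides (divides (+ N) (begin
    + (r ℕ.+ N ℕ.* d) - + r
      ≡⟨ cong (_- + r) (trans (pos-+ r (N ℕ.* d)) (cong (_+_ (+ r)) (pos-* N d))) ⟩
    + r + + N * + d - + r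
      ≡⟨ cancel (+ r) (+ N * + d) ⟩
    + N * + d ∎))
    where
    cancel : ∀ r t → r + t - r ≡ t
    cancel = solve-∀

lemma3p1 : (m : ℕ) → m % 4 ≡ 0 → ¬ AlmostUniversal m
lemma3p1 m m%4≡0 with 4∣m⇒m≡8j∨m≡4+8j (m%n≡0⇒n∣m m 4 m%4≡0)
... | j , inj₁ refl = misses-residue⇒¬AlmostUniversal (j ℕ.* 8) 8 4 (P[8j]≢4-mod-8 j)
... | j , inj₂ refl = misses-residue⇒¬AlmostUniversal (4 ℕ.+ j ℕ.* 8) 8 7 (P[4+8j]≢7-mod-8 j)
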